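{- Let $G$ be a strongly connected compressed directed graph that is not a closed path, and let $fg$ be a central-micro omnitig of $G$. Then: (i) there is at most one maximal right-micro omnitig of the form $fgW$, and at most one maximal left-micro omnitig of the form $Wfg$; (ii) there is a unique maximal microtig containing $fg$.
   Context: Graphs are finite directed multigraphs (parallel arcs and self-loops allowed); $t(e)$, $h(e)$ are tail and head of arc $e$. A path is a walk with distinct nodes except the last may equal the first. A closed path is a graph consisting of a single cycle. A node is a join node if its in-degree exceeds 1, a split node if its out-degree exceeds 1, biunivocal if neither. An arc $e$ is a join arc if $h(e)$ is a join node, a split arc if $t(e)$ is a split node, bivalent if both, biunivocal if neither. A graph is compressed if it has no biunivocal nodes and no biunivocal arcs. A walk $W=e_0\dots e_\ell$ is an omnitig if for all $1\le i\le j\le \ell$ there is no non-empty path from $t(e_j)$ to $h(e_{i-1})$ whose first arc differs from $e_j$ and whose last arc differs from $e_{i-1}$. A central-micro omnitig is an omnitig $fg$ with $f$ a join arc and $g$ a split arc. A right-micro omnitig (resp. left-micro omnitig) is an omnitig $fgW$ (resp. $Wfg$), with $fg$ a central-micro omnitig, not containing a bivalent arc as an internal arc (an arc other than its first and last). A microtig is a walk $W_1fgW_2$ where $W_1fg$ is a left-micro omnitig and $fgW_2$ a right-micro omnitig. Maximality of such a walk means it cannot be extended by one arc on either side to a walk of the same kind (for right-micro omnitigs: not extendable on the right). -}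

module Defs where

open import Data.Nat using (ℕ; zero; suc; _<_; _≤_)
open import Data.Fin using (Fin; toℕ; _≟_)
open import Data.List using (List; []; _∷_; _++_; map; length; filter; allFin; lookup; [_])
open import Data.List.Membership.Propositional using (_∈_)
open import Data.List.Relation.Unary.Linked using (Linked)
open import Data.Product using (Σ; ∃; _×_; _,_)
open import Data.Sum using (_⊎_)
open import Relation.Nullary using (¬_)
open import Relation.Binary.PropositionalEquality using (_≡_; _≢_)

-- A finite directed multigraph: nodes Fin n, arcs Fin m, tail t and head h.
-- Parallel arcs and self-loops are allowed.
record Graph : Set where
  field
    n : ℕ
    m : ℕ
    t : Fin m → Fin n
    h : Fin m → Fin n

module _ (G : Graph) where
  open Graph G

  Node : Set
  Node = Fin n

  Arc : Set
  Arc = Fin m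

  indeg : Node → ℕ
  indeg v = length (filter (λ e → h e ≟ v) (allFin m))

  outdeg : Node → ℕ
  outdeg v = length (filter (λ e → t e ≟ v) (allFin m))

  JoinNode SplitNode BiunivocalNode : Node → Set
  JoinNode v = 1 < indeg v
  SplitNode v = 1 < outdeg v
  BiunivocalNode v = ¬ JoinNode v × ¬ SplitNode v

  JoinArc SplitArc BivalentArc BiunivocalArc : Arc → Set
  JoinArc e = JoinNode (h e)
  SplitArc e = SplitNode (t e)
  BivalentArc e = JoinArc e × SplitArc e
  BiunivocalArc e = ¬ JoinArc e × ¬ SplitArc e

  Compressed : Set
  Compressed = (∀ v → ¬ BiunivocalNode v) × (∀ e → ¬ BiunivocalArc e)

  IsWalk : List Arc → Set
  IsWalk = Linked (λ e e′ → h e ≡ t e′)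

  lastArc : Arc → List Arc → Arc
  lastArc e [] = e
  lastArc e (x ∷ xs) = lastArc x xs

  nodes : Arc → List Arc → List Node
  nodes e es = t e ∷ map h (e ∷ es)

  -- a (non-empty) path: a walk whose nodes are distinct, except that the
  -- last node may equal the first
  IsPath : Arc → List Arc → Set
  IsPath e es = IsWalk (e ∷ es) ×
    ((i j : Fin (length (nodes e es))) → toℕ i < toℕ j →
      ¬ (toℕ i ≡ 0 × toℕ j ≡ length (e ∷ es)) →
      lookup (nodes e es) i ≢ lookup (nodes e es) j)

  WalkFromTo : Node → Node → Set
  WalkFromTo u v = Σ Arc λ e → Σ (List Arc) λ es →
    IsWalk (e ∷ es) × t e ≡ u × h (lastArc e es) ≡ v

  Reachable : Node → Node → Set
  Reachable u v = u ≡ v ⊎ WalkFromTo u v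

  StronglyConnected : Set
  StronglyConnected = ∀ u v → Reachable u v

  IsClosedPath : Set
  IsClosedPath = Σ Arc λ e → Σ (List Arc) λ es →
    IsPath e es × h (lastArc e es) ≡ t e ×
    (∀ a → a ∈ e ∷ es) × (∀ v → v ∈ nodes e es)

  AvoidingPath : Node → Node → Arc → Arc → Set
  AvoidingPath u v a b = Σ Arc λ e → Σ (List Arc) λ es →
    IsPath e es × t e ≡ u × h (lastArc e es) ≡ v × e ≢ a × lastArc e es ≢ b

  -- Omnitig W = e₀…e_ℓ.  The index pair (i-1, j) with 1 ≤ i ≤ j ≤ ℓ is
  -- written as (a, j) with a < j (a = i-1).
  IsOmnitig : List Arc → Set
  IsOmnitig W = IsWalk W × (1 ≤ length W) ×
    ((a j : Fin (length W)) → toℕ a < toℕ j →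
      ¬ AvoidingPath (t (lookup W j)) (h (lookup W a)) (lookup W j) (lookup W a))

  NoInternalBivalent : List Arc → Set
  NoInternalBivalent W = (i : Fin (length W)) → 0 < toℕ i → suc (toℕ i) < length W →
    ¬ BivalentArc (lookup W i)

  CentralMicro : Arc → Arc → Set
  CentralMicro f g = IsOmnitig (f ∷ g ∷ []) × JoinArc f × SplitArc g

  RightMicro : Arc → Arc → List Arc → Set
  RightMicro f g W = CentralMicro f g × IsOmnitig (f ∷ g ∷ W) × NoInternalBivalent (f ∷ g ∷ W)

  LeftMicro : List Arc → Arc → Arc → Set
  LeftMicro W f g = CentralMicro f g × IsOmnitig (W ++ f ∷ g ∷ []) ×
    NoInternalBivalent (W ++ f ∷ g ∷ [])

  MaximalRightMicro : Arc → Arc → List Arc → Set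
  MaximalRightMicro f g W = RightMicro f g W × (∀ e → ¬ RightMicro f g (W ++ [ e ]))

  MaximalLeftMicro : List Arc → Arc → Arc → Set
  MaximalLeftMicro W f g = LeftMicro W f g × (∀ e → ¬ LeftMicro (e ∷ W) f g)

  MicrotigAt : Arc → Arc → List Arc → Set
  MicrotigAt f g W = Σ (List Arc) λ W₁ → Σ (List Arc) λ W₂ →
    W ≡ W₁ ++ f ∷ g ∷ W₂ × LeftMicro W₁ f g × RightMicro f g W₂

  Microtig : List Arc → Set
  Microtig W = Σ Arc λ f → Σ Arc λ g → MicrotigAt f g W

  MaximalMicrotig : List Arc → Set
  MaximalMicrotig W = Microtig W × (∀ e → ¬ Microtig (e ∷ W)) × (∀ e → ¬ Microtig (W ++ [ e ]))

-- In a compressed graph, the arcs of a right-micro omnitig f g W after g are non-join (except the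
-- last one), and the arcs of a left-micro omnitig W f g before f are non-split (except the first).
-- An omnitig L containing a join arc has at most one one-arc extension L e: if b is the last join
-- arc of L and b′ ≠ b another arc into h(b), strong connectivity gives a closed path through h(b)
-- ending with b′, and the omnitig condition forces this path to run along L after b and then
-- through e. Since right-micro omnitigs are closed under prefixes, the maximal one is unique; the
-- left case is dual, using the first split arc. Maximal ones exist because the omnitig property is
-- decidable (paths are short) and a micro omnitig repeats no arc before its last one: through
-- non-join (non-split) arcs a walk is determined backwards (forwards). Finally the join/split
-- pattern pins down the central pair of a microtig, so the unique maximal microtig through fg is
-- Lmax f g Rmax.

module Submission where

open import Defs
open import Data.List using (List)
open import Data.Product using (Σ; _×_)
open import Relation.Nullary using (¬_)
open import Relation.Binary.PropositionalEquality using (_≡_)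

open import Data.Empty using (⊥; ⊥-elim)
open import Data.Fin as Fin using (Fin; toℕ; _≟_)
import Data.Fin.Properties as Finₚ
open import Data.List using ([]; _∷_; _++_; _∷ʳ_; [_]; map; length; lookup; reverse; drop; filter; allFin)
open import Data.List.Properties
  using (++-assoc; ++-identityʳ; ++-cancelˡ; ++-cancelʳ; ∷-injectiveˡ; ∷-injectiveʳ; ∷ʳ-injectiveʳ; ∷ʳ-++;
         map-++; length-map; length-++; length-++-≤ˡ; length-reverse;
         unfold-reverse; reverse-++; reverse-involutive; reverse-injective)
open import Data.List.Membership.Propositional using (_∈_)
import Data.List.Membership.DecPropositional as DecMembership
open import Data.List.Membership.Propositional.Properties
  using (∈-lookup; ∈-++⁺ʳ; ∈-filter⁺; ∈-filter⁻; ∈-allFin)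
open import Data.List.Relation.Unary.All as All using (All; []; _∷_)
open import Data.List.Relation.Unary.All.Properties using (¬Any⇒All¬; ++⁻ˡ; ∷ʳ⁻; drop⁺)
open import Data.List.Relation.Unary.AllPairs using ([]; _∷_)
open import Data.List.Relation.Unary.Any using (Any; here; there; any?)
import Data.List.Relation.Unary.Any.Properties as Anyₚ
open import Data.List.Relation.Unary.Linked as Linked using (Linked; []; [-]; _∷_)
open import Data.List.Relation.Unary.Unique.Propositional using (Unique)
open import Data.List.Reverse using (Reverse; []; _∶_∶ʳ_; reverseView)
import Data.List.Relation.Unary.Unique.Propositional.Properties as UniqueP
open import Data.Nat using (ℕ; zero; suc; _+_; _<_; _≤_; _≤?_; z≤n; s≤s)
import Data.Nat.Properties as ℕₚ
open import Data.Product using (∃; ∃-syntax; _,_; proj₁; proj₂)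
open import Data.Sum using (_⊎_; inj₁; inj₂)
import Data.Sum as Sum
open import Data.Unit using (⊤; tt)
open import Function using (_∘_; flip)
open import Relation.Nullary using (Dec; yes; no; ¬?)
open import Relation.Nullary.Decidable using (_×-dec_; _→-dec_)
import Relation.Nullary.Decidable as Dec
open import Relation.Unary using (Decidable)
open import Relation.Binary.Definitions using (DecidableEquality)
open import Relation.Binary.PropositionalEquality using (module ≡-Reasoning; refl; sym; trans; cong; cong₂; subst; subst₂; _≢_; ≢-sym)

module _ {A : Set} where

  length-∷ʳ : ∀ (xs : List A) {x} → length (xs ∷ʳ x) ≡ suc (length xs)
  length-∷ʳ xs = trans (length-++ xs) (ℕₚ.+-comm (length xs) 1)

  lookup-++ˡ : (xs ys : List A) (i : Fin (length xs)) →
    ∃ λ (i′ : Fin (length (xs ++ ys))) → toℕ i′ ≡ toℕ i × lookup (xs ++ ys) i′ ≡ lookup xs i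
  lookup-++ˡ (x ∷ xs) ys Fin.zero = Fin.zero , refl , refl
  lookup-++ˡ (x ∷ xs) ys (Fin.suc i) =
    let i′ , p , q = lookup-++ˡ xs ys i in Fin.suc i′ , cong suc p , q

  lookup-++ʳ : (xs ys : List A) (i : Fin (length ys)) →
    ∃ λ (i′ : Fin (length (xs ++ ys))) → toℕ i′ ≡ length xs + toℕ i × lookup (xs ++ ys) i′ ≡ lookup ys i
  lookup-++ʳ [] ys i = i , refl , refl
  lookup-++ʳ (x ∷ xs) ys i =
    let i′ , p , q = lookup-++ʳ xs ys i in Fin.suc i′ , cong suc p , q

  lookup-∷ʳ : (xs : List A) (x : A) (i : Fin (length (xs ∷ʳ x))) →
    (toℕ i ≡ length xs × lookup (xs ∷ʳ x) i ≡ x) ⊎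
    (∃ λ (i′ : Fin (length xs)) → toℕ i′ ≡ toℕ i × lookup (xs ∷ʳ x) i ≡ lookup xs i′)
  lookup-∷ʳ [] x Fin.zero = inj₁ (refl , refl)
  lookup-∷ʳ (y ∷ xs) x Fin.zero = inj₂ (Fin.zero , refl , refl)
  lookup-∷ʳ (y ∷ xs) x (Fin.suc i) =
    Sum.map (λ (p , q) → cong suc p , q) (λ (i′ , p , q) → Fin.suc i′ , cong suc p , q) (lookup-∷ʳ xs x i)

  position : ∀ {W : List A} P {x} R → W ≡ P ++ x ∷ R →
    ∃ λ (i : Fin (length W)) → toℕ i ≡ length P × lookup W i ≡ x
  position P R refl =
    let i , i≡ , li = lookup-++ʳ P (_ ∷ R) Fin.zero in i , trans i≡ (ℕₚ.+-identityʳ _) , li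

  lookup-injective : ∀ {xs : List A} → Unique xs → ∀ i j → lookup xs i ≡ lookup xs j → i ≡ j
  lookup-injective {_ ∷ _} _ Fin.zero Fin.zero _ = refl
  lookup-injective {_ ∷ _} (x∉ ∷ _) Fin.zero (Fin.suc j) eq = ⊥-elim (All.lookup x∉ (∈-lookup j) eq)
  lookup-injective {_ ∷ _} (x∉ ∷ _) (Fin.suc i) Fin.zero eq = ⊥-elim (All.lookup x∉ (∈-lookup i) (sym eq))
  lookup-injective {_ ∷ _} (_ ∷ u) (Fin.suc i) (Fin.suc j) eq = cong Fin.suc (lookup-injective u i j eq)

  unique-rotate : ∀ (xs : List A) {z} → Unique (xs ∷ʳ z) → Unique (z ∷ xs)
  unique-rotate [] _ = [] ∷ []
  unique-rotate (x ∷ xs) (x∉ ∷ u) with z∉ ∷ u′ ← unique-rotate xs u =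
    (≢-sym (All.lookup x∉ (∈-++⁺ʳ xs (here refl))) ∷ z∉) ∷ ++⁻ˡ xs x∉ ∷ u′

  all-reverse : ∀ {P : A → Set} {xs} → All P xs → All P (reverse xs)
  all-reverse pxs = All.tabulate (λ x∈ → All.lookup pxs (Anyₚ.reverse⁻ x∈))

  linked-++ˡ : ∀ {R : A → A → Set} (xs : List A) {ys} → Linked R (xs ++ ys) → Linked R xs
  linked-++ˡ [] _ = []
  linked-++ˡ (x ∷ []) _ = [-]
  linked-++ˡ (x ∷ y ∷ xs) (r ∷ l) = r ∷ linked-++ˡ (y ∷ xs) l

  linked-++ʳ : ∀ {R : A → A → Set} (xs : List A) {ys} → Linked R (xs ++ ys) → Linked R ys
  linked-++ʳ [] l = l
  linked-++ʳ (x ∷ xs) l = linked-++ʳ xs (Linked.tail l)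

  linked-∷ʳ : ∀ {R : A → A → Set} (xs : List A) {y z} →
    Linked R (xs ∷ʳ y) → R y z → Linked R (xs ∷ʳ y ∷ʳ z)
  linked-∷ʳ [] _ r = r ∷ [-]
  linked-∷ʳ (x ∷ []) (r′ ∷ _) r = r′ ∷ r ∷ [-]
  linked-∷ʳ (x ∷ x′ ∷ xs) (r′ ∷ l) r = r′ ∷ linked-∷ʳ (x′ ∷ xs) l r

  -- The node condition of IsPath, k being the index of the last node.
  DistinctExcept : ℕ → List A → Set
  DistinctExcept k xs = (i j : Fin (length xs)) → toℕ i < toℕ j → ¬ (toℕ i ≡ 0 × toℕ j ≡ k) →
    lookup xs i ≢ lookup xs j

  distinctExcept-closed : ∀ x V → Unique (x ∷ V) → DistinctExcept (suc (length V)) ((x ∷ V) ∷ʳ x)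
  distinctExcept-closed x V u i j i<j not-ends eq with lookup-∷ʳ (x ∷ V) x i | lookup-∷ʳ (x ∷ V) x j
  ... | inj₁ (i≡ , _) | inj₁ (j≡ , _) = ℕₚ.<-irrefl (trans i≡ (sym j≡)) i<j
  ... | inj₁ (i≡ , _) | inj₂ (j′ , j′≡ , _) =
    ℕₚ.<-asym i<j (subst₂ _<_ j′≡ (sym i≡) (Finₚ.toℕ<n j′))
  ... | inj₂ (i′ , i′≡ , li) | inj₁ (j≡ , lj) =
    not-ends (trans (sym i′≡) (cong toℕ (lookup-injective u i′ Fin.zero (trans (sym li) (trans eq lj)))) , j≡)
  ... | inj₂ (i′ , i′≡ , li) | inj₂ (j′ , j′≡ , lj) =
    ℕₚ.<-irrefl (trans (sym i′≡) (trans (cong toℕ (lookup-injective u i′ j′ (trans (sym li) (trans eq lj)))) j′≡))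
      i<j

  distinctExcept-++ˡ : ∀ {k} k′ xs ys → length xs ≤ k → DistinctExcept k (xs ++ ys) → DistinctExcept k′ xs
  distinctExcept-++ˡ k′ xs ys xs≤k d i j i<j _ eq =
    let i′ , i′≡ , li = lookup-++ˡ xs ys i
        j′ , j′≡ , lj = lookup-++ˡ xs ys j
    in d i′ j′ (subst₂ _<_ (sym i′≡) (sym j′≡) i<j)
         (λ (_ , j′≡k) → ℕₚ.<-irrefl (trans (sym j′≡) j′≡k) (ℕₚ.<-≤-trans (Finₚ.toℕ<n j) xs≤k))
         (trans li (trans eq (sym lj)))

  distinctExcept? : DecidableEquality A → ∀ k xs → Dec (DistinctExcept k xs)
  distinctExcept? _≟ᴬ_ k xs = Finₚ.all? λ i → Finₚ.all? λ j →
    (toℕ i ℕₚ.<? toℕ j) →-dec ¬? ((toℕ i ℕₚ.≟ 0) ×-dec (toℕ j ℕₚ.≟ k)) →-dec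
    ¬? (lookup xs i ≟ᴬ lookup xs j)

length-unique-≤ : ∀ {m} {xs : List (Fin m)} → Unique xs → length xs ≤ m
length-unique-≤ {m} {xs} u with length xs ≤? m
... | yes le = le
... | no gt = let i , j , i<j , eq = Finₚ.pigeonhole (ℕₚ.≰⇒> gt) (lookup xs) in
  ⊥-elim (Finₚ.<-irrefl (lookup-injective u i j eq) i<j)

any-list≤? : ∀ {m} {P : List (Fin m) → Set} → (∀ xs → Dec (P xs)) →
  ∀ k → Dec (∃ λ xs → length xs ≤ k × P xs)
any-list≤? P? k with P? []
... | yes p[] = yes ([] , z≤n , p[])
any-list≤? P? zero | no ¬p[] = no λ { ([] , _ , p[]) → ¬p[] p[] ; (_ ∷ _ , () , _) }
any-list≤? P? (suc k) | no ¬p[] with Finₚ.any? (λ e → any-list≤? (P? ∘ (e ∷_)) k)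
... | yes (e , xs , xs≤k , p) = yes (e ∷ xs , s≤s xs≤k , p)
... | no ¬p = no λ { ([] , _ , p[]) → ¬p[] p[] ; (e ∷ xs , s≤s xs≤k , p) → ¬p (e , xs , xs≤k , p) }

module _ {A : Set} {P : A → Set} (P? : Decidable P) where

  split-first : ∀ {xs} → Any P xs → ∃[ B ] ∃[ b ] ∃[ C ] xs ≡ B ++ b ∷ C × All (¬_ ∘ P) B × P b
  split-first {x ∷ xs} p with P? x | p
  ... | yes px | _ = [] , x , xs , refl , [] , px
  ... | no ¬px | here px = ⊥-elim (¬px px)
  ... | no ¬px | there p′ =
    let B , b , C , eq , ¬pB , pb = split-first p′ in x ∷ B , b , C , cong (x ∷_) eq , ¬px ∷ ¬pB , pb

  split-last : ∀ {xs} → Any P xs → ∃[ B ] ∃[ b ] ∃[ C ] xs ≡ B ++ b ∷ C × P b × All (¬_ ∘ P) C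
  split-last {x ∷ xs} p with any? P? xs | p
  ... | yes p′ | _ =
    let B , b , C , eq , pb , ¬pC = split-last p′ in x ∷ B , b , C , cong (x ∷_) eq , pb , ¬pC
  ... | no ¬p′ | here px = [] , x , xs , refl , px , ¬Any⇒All¬ xs ¬p′
  ... | no ¬p′ | there p′ = ⊥-elim (¬p′ p′)

module _ {A : Set} (P : A → Set) where

  AllButLast : List A → Set
  AllButLast [] = ⊤
  AllButLast (x ∷ []) = ⊤
  AllButLast (x ∷ y ∷ xs) = P x × AllButLast (y ∷ xs)

  AllButFirst : List A → Set
  AllButFirst xs = All P (drop 1 xs)

  allButLast-∷ʳ : ∀ xs {z} → AllButLast (xs ∷ʳ z) → All P xs
  allButLast-∷ʳ [] _ = []
  allButLast-∷ʳ (x ∷ []) (px , _) = px ∷ []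
  allButLast-∷ʳ (x ∷ y ∷ xs) (px , pxs) = px ∷ allButLast-∷ʳ (y ∷ xs) pxs

  allButLast-middle : ∀ xs {y z zs} → AllButLast (xs ++ y ∷ z ∷ zs) → P y
  allButLast-middle [] (py , _) = py
  allButLast-middle (x ∷ []) (_ , pxs) = allButLast-middle [] pxs
  allButLast-middle (x ∷ x′ ∷ xs) (_ , pxs) = allButLast-middle (x′ ∷ xs) pxs

module _ {A : Set} {P Q : A → Set} where

  -- f cannot lie inside g′ V₂ before its last arc, and g cannot lie in the tail of V₁ f′.
  center-unique : ∀ V₁ {f′ g′ V₂} As {f g B} → V₁ ++ f′ ∷ g′ ∷ V₂ ≡ As ++ f ∷ g ∷ B →
    AllButFirst (¬_ ∘ Q) (V₁ ∷ʳ f′) → AllButLast (¬_ ∘ P) (g′ ∷ V₂) → P f → Q g → V₁ ≡ As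
  center-unique [] [] _ _ _ _ _ = refl
  center-unique (v ∷ []) [] eq (¬qf′ ∷ _) _ _ qg =
    ⊥-elim (¬qf′ (subst Q (sym (∷-injectiveˡ (∷-injectiveʳ eq))) qg))
  center-unique (v ∷ u ∷ V) [] eq (¬qu ∷ _) _ _ qg =
    ⊥-elim (¬qu (subst Q (sym (∷-injectiveˡ (∷-injectiveʳ eq))) qg))
  center-unique [] (a ∷ As) eq _ ¬p pf =
    ⊥-elim (allButLast-middle _ As (subst (AllButLast _) (∷-injectiveʳ eq) ¬p) pf)
  center-unique (v ∷ V) (a ∷ As) eq ¬q ¬p pf qg =
    cong₂ _∷_ (∷-injectiveˡ eq) (center-unique V As (∷-injectiveʳ eq) (drop⁺ 1 ¬q) ¬p pf qg)

module _ {A : Set} {R : A → A → Set} where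

  linked-reverse : ∀ {xs} → Linked R xs → Linked (flip R) (reverse xs)
  linked-reverse [] = []
  linked-reverse [-] = [-]
  linked-reverse {x ∷ y ∷ xs} (r ∷ l) =
    subst (Linked (flip R)) (sym (trans (unfold-reverse x (y ∷ xs)) (cong (_∷ʳ x) (unfold-reverse y xs))))
      (linked-∷ʳ (reverse xs) (subst (Linked (flip R)) (unfold-reverse y xs) (linked-reverse l)) r)

  module _ {Good : A → Set} (functional : ∀ {x y z} → Good z → R x z → R x y → y ≡ z) where

    private
      successor-∈ : ∀ zs {x a p} → Linked R (a ∷ (zs ∷ʳ p)) → x ∈ a ∷ (zs ∷ʳ p) →
        x ≡ p ⊎ ∃ λ y → R x y × y ∈ zs ∷ʳ p
      successor-∈ [] (r ∷ _) (here refl) = inj₂ (_ , r , here refl)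
      successor-∈ [] _ (there (here refl)) = inj₁ refl
      successor-∈ (b ∷ zs) (r ∷ _) (here refl) = inj₂ (b , r , here refl)
      successor-∈ (b ∷ zs) (_ ∷ l) (there i) =
        Sum.map₂ (λ (y , r , j) → y , r , there j) (successor-∈ zs l i)

    -- A second occurrence of x would be followed by the successor of its first occurrence.
    unique-chain : ∀ xs {p} → Linked R (xs ∷ʳ p) → All Good xs → ¬ Good p → Unique (xs ∷ʳ p)
    unique-chain [] _ _ _ = [] ∷ []
    unique-chain (x ∷ xs) {p} l (gx ∷ gxs) ¬gp = All.tabulate x≢ ∷ u
      where
      u = unique-chain xs (Linked.tail l) gxs ¬gp
      x∉ : ∀ xs → Linked R (x ∷ (xs ∷ʳ p)) → All Good xs → Unique (xs ∷ʳ p) → ¬ x ∈ xs ∷ʳ p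
      x∉ [] _ _ _ (here refl) = ¬gp gx
      x∉ (a ∷ xs) (r ∷ l) (ga ∷ _) (a∉ ∷ _) x∈ with successor-∈ xs l x∈
      ... | inj₁ refl = ¬gp gx
      ... | inj₂ (y , r′ , y∈) = All.lookup a∉ y∈ (sym (functional ga r r′))
      x≢ : ∀ {z} → z ∈ xs ∷ʳ p → x ≢ z
      x≢ z∈ refl = x∉ xs l gxs u z∈

module Maximality {A : Set} (P : List A → Set) where

  Maximal : List A → Set
  Maximal X = P X × (∀ e → ¬ P (X ∷ʳ e))

  maximal-unique : (∀ X Y → P (X ++ Y) → P X) →
    (∀ X {e e′} → P (X ∷ʳ e) → P (X ∷ʳ e′) → e ≡ e′) →
    ∀ {X Y} → Maximal X → Maximal Y → X ≡ Y
  maximal-unique prefix-closed deterministic = go []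
    where
    step : ∀ Z {x X} → P (Z ++ x ∷ X) → P (Z ∷ʳ x)
    step Z {x} {X} p = prefix-closed (Z ∷ʳ x) X (subst P (sym (∷ʳ-++ Z x X)) p)

    unextendable : ∀ Z {y Y} → Maximal (Z ++ []) → P (Z ++ y ∷ Y) → ⊥
    unextendable Z {y} (_ , max) p = max y (subst (λ W → P (W ∷ʳ y)) (sym (++-identityʳ Z)) (step Z p))

    go : ∀ Z {X Y} → Maximal (Z ++ X) → Maximal (Z ++ Y) → X ≡ Y
    go Z {[]} {[]} _ _ = refl
    go Z {[]} {_ ∷ _} mX (pY , _) = ⊥-elim (unextendable Z mX pY)
    go Z {_ ∷ _} {[]} (pX , _) mY = ⊥-elim (unextendable Z mY pX)
    go Z {x ∷ X} {y ∷ Y} mX mY with deterministic Z (step Z (proj₁ mX)) (step Z (proj₁ mY))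
    ... | refl = cong (x ∷_)
      (go (Z ∷ʳ x) (subst Maximal (sym (∷ʳ-++ Z x X)) mX) (subst Maximal (sym (∷ʳ-++ Z x Y)) mY))

  maximal-exists : (∀ X → Dec (∃ λ e → P (X ∷ʳ e))) →
    (k : ℕ) → (∀ X → P X → length X ≤ k) → P [] → ∃ Maximal
  maximal-exists extendable? k bound p[] = grow (suc k) [] p[] (ℕₚ.n<1+n k)
    where
    grow : ∀ fuel X → P X → k < length X + fuel → ∃ Maximal
    grow fuel X pX k< with extendable? X | fuel
    ... | no ¬ext | _ = X , pX , λ e pXe → ¬ext (e , pXe)
    ... | yes _ | zero = ⊥-elim (ℕₚ.<⇒≱ k< (subst (_≤ k) (sym (ℕₚ.+-identityʳ _)) (bound X pX)))
    ... | yes (e , pXe) | suc fuel = grow fuel (X ∷ʳ e) pXe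
      (subst (k <_) (sym (trans (cong (_+ fuel) (length-++ X)) (ℕₚ.+-assoc (length X) 1 fuel))) k<)

module ConsMaximality {A : Set} (Q : List A → Set) where
  open Maximality (Q ∘ reverse)

  ConsMaximal : List A → Set
  ConsMaximal W = Q W × (∀ e → ¬ Q (e ∷ W))

  private
    reverse-∷ʳ : ∀ X (e : A) → reverse (X ∷ʳ e) ≡ e ∷ reverse X
    reverse-∷ʳ X e = reverse-++ X [ e ]

    consMaximal⇒maximal : ∀ {W} → ConsMaximal W → Maximal (reverse W)
    consMaximal⇒maximal {W} (qW , max) =
      subst Q (sym (reverse-involutive W)) qW ,
      λ e q → max e (subst Q (trans (reverse-∷ʳ (reverse W) e) (cong (e ∷_) (reverse-involutive W))) q)

    maximal⇒consMaximal : ∀ {X} → Maximal X → ConsMaximal (reverse X)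
    maximal⇒consMaximal {X} (qX , max) = qX , λ e q → max e (subst Q (sym (reverse-∷ʳ X e)) q)

  consMaximal-unique : (∀ X Y → Q (X ++ Y) → Q Y) →
    (∀ X {e e′} → Q (e ∷ X) → Q (e′ ∷ X) → e ≡ e′) →
    ∀ {W W′} → ConsMaximal W → ConsMaximal W′ → W ≡ W′
  consMaximal-unique suffix-closed deterministic mW mW′ =
    reverse-injective (maximal-unique prefix-closed deterministic′ (consMaximal⇒maximal mW) (consMaximal⇒maximal mW′))
    where
    prefix-closed : ∀ X Y → Q (reverse (X ++ Y)) → Q (reverse X)
    prefix-closed X Y q = suffix-closed (reverse Y) (reverse X) (subst Q (reverse-++ X Y) q)
    deterministic′ : ∀ X {e e′} → Q (reverse (X ∷ʳ e)) → Q (reverse (X ∷ʳ e′)) → e ≡ e′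
    deterministic′ X {e} {e′} q q′ =
      deterministic (reverse X) (subst Q (reverse-∷ʳ X e) q) (subst Q (reverse-∷ʳ X e′) q′)

  consMaximal-exists : (∀ W → Dec (∃ λ e → Q (e ∷ W))) →
    (k : ℕ) → (∀ W → Q W → length W ≤ k) → Q [] → ∃ ConsMaximal
  consMaximal-exists extendable? k bound q[] =
    let X , mX = maximal-exists extendable?′ k bound′ q[] in reverse X , maximal⇒consMaximal {X} mX
    where
    extendable?′ : ∀ X → Dec (∃ λ e → Q (reverse (X ∷ʳ e)))
    extendable?′ X = Dec.map′ (λ (e , q) → e , subst Q (sym (reverse-∷ʳ X e)) q)
                              (λ (e , q) → e , subst Q (reverse-∷ʳ X e) q) (extendable? (reverse X))
    bound′ : ∀ X → Q (reverse X) → length X ≤ k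
    bound′ X q = subst (_≤ k) (length-reverse X) (bound (reverse X) q)

module Degree {n m : ℕ} (end : Fin m → Fin n) (v : Fin n) where

  private
    end≟v : ∀ e → Dec (end e ≡ v)
    end≟v e = end e ≟ v

  arcsAt : List (Fin m)
  arcsAt = filter end≟v (allFin m)

  unique-arc : ¬ (1 < length arcsAt) → ∀ {a a′} → end a ≡ v → end a′ ≡ v → a ≡ a′
  unique-arc ≤1 {a} {a′} ea ea′ = go arcsAt ≤1 (∈-filter⁺ end≟v (∈-allFin a) ea) (∈-filter⁺ end≟v (∈-allFin a′) ea′)
    where
    go : ∀ xs → ¬ (1 < length xs) → a ∈ xs → a′ ∈ xs → a ≡ a′
    go (x ∷ []) _ (here refl) (here refl) = refl
    go (x ∷ y ∷ xs) ≤1 _ _ = ⊥-elim (≤1 (s≤s (s≤s z≤n)))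

  other-arc : 1 < length arcsAt → ∀ b → ∃ λ b′ → b′ ≢ b × end b′ ≡ v
  other-arc >1 b =
    go arcsAt >1 (UniqueP.filter⁺ end≟v (UniqueP.allFin⁺ m)) (λ x∈ → proj₂ (∈-filter⁻ end≟v {xs = allFin m} x∈))
    where
    go : ∀ xs → 1 < length xs → Unique xs → (∀ {x} → x ∈ xs → end x ≡ v) → ∃ λ b′ → b′ ≢ b × end b′ ≡ v
    go (x ∷ []) (s≤s ()) _ _
    go (x ∷ y ∷ xs) _ ((x≢y ∷ _) ∷ _) ends with x ≟ b | y ≟ b
    ... | no x≢b | _ = x , x≢b , ends (here refl)
    ... | yes _ | no y≢b = y , y≢b , ends (there (here refl))
    ... | yes refl | yes refl = ⊥-elim (x≢y refl)

module _ (G : Graph) where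
  open Graph G

  nonJoin-unique : ∀ {x y} → ¬ JoinArc G x → h y ≡ h x → y ≡ x
  nonJoin-unique {x} ¬jx hy = Degree.unique-arc h (h x) ¬jx hy refl

  nonSplit-unique : ∀ {x y} → ¬ SplitArc G x → t y ≡ t x → y ≡ x
  nonSplit-unique {x} ¬sx ty = Degree.unique-arc t (t x) ¬sx ty refl

  join⇒another-arc : ∀ {b} → JoinArc G b → ∃ λ b′ → b′ ≢ b × h b′ ≡ h b
  join⇒another-arc {b} jb = Degree.other-arc h (h b) jb b

  split⇒another-arc : ∀ {b} → SplitArc G b → ∃ λ b′ → b′ ≢ b × t b′ ≡ t b
  split⇒another-arc {b} sb = Degree.other-arc t (t b) sb b

  joinArc? : ∀ a → Dec (JoinArc G a)
  joinArc? a = 1 ℕₚ.<? indeg G (h a)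

  splitArc? : ∀ a → Dec (SplitArc G a)
  splitArc? a = 1 ℕₚ.<? outdeg G (t a)

  ∷-lastArc : ∀ d ds → ∃ λ Q → d ∷ ds ≡ Q ∷ʳ lastArc G d ds
  ∷-lastArc d [] = [] , refl
  ∷-lastArc d (d′ ∷ ds) = let Q , eq = ∷-lastArc d′ ds in d ∷ Q , cong (d ∷_) eq

  lastArc-∷ʳ : ∀ b M c → lastArc G b (M ∷ʳ c) ≡ c
  lastArc-∷ʳ b [] c = refl
  lastArc-∷ʳ b (x ∷ M) c = lastArc-∷ʳ x M c

  walk-link : ∀ b M {y R} → IsWalk G (b ∷ M ++ y ∷ R) → h (lastArc G b M) ≡ t y
  walk-link b [] (l ∷ _) = l
  walk-link b (c ∷ M) (_ ∷ w) = walk-link c M w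

  path-tail : ∀ {d d′ ds} → IsPath G d (d′ ∷ ds) → IsPath G d′ ds
  path-tail {d} {d′} {ds} (l ∷ w , distinct) =
    w , λ i j i<j _ eq → distinct (Fin.suc i) (Fin.suc j) (s≤s i<j) (λ ()) (trans (shift i) (trans eq (sym (shift j))))
    where
    shift : ∀ i → lookup (nodes G d (d′ ∷ ds)) (Fin.suc i) ≡ lookup (nodes G d′ ds) i
    shift Fin.zero = l
    shift (Fin.suc i) = refl

  path-init : ∀ {d} ds {x} → IsPath G d (ds ∷ʳ x) → IsPath G d ds
  path-init {d} ds {x} (w , distinct) =
    linked-++ˡ (d ∷ ds) w ,
    distinctExcept-++ˡ _ (nodes G d ds) [ h x ] (ℕₚ.≤-reflexive length-nodes)
      (subst (DistinctExcept _) (cong (λ hs → t d ∷ h d ∷ hs) (map-++ h ds [ x ])) distinct)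
    where
    length-nodes : length (nodes G d ds) ≡ length (d ∷ ds ∷ʳ x)
    length-nodes = cong suc (trans (cong suc (length-map h ds)) (sym (length-∷ʳ ds)))

  closedWalk⇒path : ∀ {u V} d ds → IsWalk G (d ∷ ds) → t d ≡ u → map h (d ∷ ds) ≡ V ∷ʳ u →
    Unique (u ∷ V) → IsPath G d ds
  closedWalk⇒path {u} {V} d ds w td hs u∷V =
    w , subst₂ DistinctExcept length-eq (sym (cong₂ _∷_ td hs)) (distinctExcept-closed u V u∷V)
    where
    length-eq : suc (length V) ≡ length (d ∷ ds)
    length-eq = sym (trans (sym (length-map h (d ∷ ds))) (trans (cong length hs) (length-∷ʳ V)))

  path-length : ∀ {e es} → IsPath G e es → length es ≤ n
  path-length {e} {es} (_ , distinct) with length (map h (e ∷ es)) ≤? n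
  ... | yes ≤n = ℕₚ.≤-trans (ℕₚ.n≤1+n _) (subst (_≤ n) (length-map h (e ∷ es)) ≤n)
  ... | no >n =
    let i , j , i<j , eq = Finₚ.pigeonhole (ℕₚ.≰⇒> >n) (λ k → lookup (nodes G e es) (Fin.suc k))
    in ⊥-elim (distinct (Fin.suc i) (Fin.suc j) (s≤s i<j) (λ ()) eq)

  Walk : Fin n → List (Fin m) → Fin n → Set
  Walk u [] v = u ≡ v
  Walk u (c ∷ cs) v = t c ≡ u × Walk (h c) cs v

  walk-++ : ∀ {u v w} P {Q} → Walk u P v → Walk v Q w → Walk u (P ++ Q) w
  walk-++ [] refl q = q
  walk-++ (c ∷ P) (tc , p) q = tc , walk-++ P p q

  walk⇒isWalk : ∀ {u v} d ds → Walk u (d ∷ ds) v → IsWalk G (d ∷ ds) × t d ≡ u × h (lastArc G d ds) ≡ v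
  walk⇒isWalk d [] (td , hd) = [-] , td , hd
  walk⇒isWalk d (d′ ∷ ds) (td , w) =
    let iw , td′ , hl = walk⇒isWalk d′ ds w in sym td′ ∷ iw , td , hl

  isWalk⇒walk : ∀ d ds → IsWalk G (d ∷ ds) → Walk (t d) (d ∷ ds) (h (lastArc G d ds))
  isWalk⇒walk d [] _ = refl , refl
  isWalk⇒walk d (d′ ∷ ds) (l ∷ w) =
    refl , subst (λ u → Walk u (d′ ∷ ds) (h (lastArc G d′ ds))) (sym l) (isWalk⇒walk d′ ds w)

  reachable⇒walk : ∀ {u v} → Reachable G u v → ∃ λ es → Walk u es v
  reachable⇒walk (inj₁ u≡v) = [] , u≡v
  reachable⇒walk (inj₂ (d , ds , w , refl , refl)) = d ∷ ds , isWalk⇒walk d ds w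

  walk-nodes : ∀ {u v} es → Walk u es v → ∃ λ V → u ∷ map h es ≡ V ∷ʳ v
  walk-nodes [] refl = [] , refl
  walk-nodes {u} (c ∷ cs) (_ , w) = let V , eq = walk-nodes cs w in u ∷ V , cong (u ∷_) eq

  SimpleWalk : Fin n → List (Fin m) → Fin n → Set
  SimpleWalk u es v = Walk u es v × Unique (u ∷ map h es)

  simple-suffix : ∀ {u w v} es → SimpleWalk w es v → u ∈ w ∷ map h es → ∃ λ es′ → SimpleWalk u es′ v
  simple-suffix es sw (here refl) = es , sw
  simple-suffix (d ∷ ds) ((_ , w) , _ ∷ u) (there i) = simple-suffix ds (w , u) i

  simplify : ∀ {u v} es → Walk u es v → ∃ λ es′ → SimpleWalk u es′ v
  simplify [] w = [] , w , [] ∷ []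
  simplify {u} (c ∷ cs) (tc , w) with simplify cs w
  ... | es′ , w′ , u′ with DecMembership._∈?_ _≟_ u (h c ∷ map h es′)
  ...   | yes u∈ = simple-suffix es′ (w′ , u′) u∈
  ...   | no u∉ = c ∷ es′ , (tc , w′) , ¬Any⇒All¬ _ u∉ ∷ u′

  module _ (sc : StronglyConnected G) (a : Fin m) where

    private
      returnWalk : ∃ λ P → SimpleWalk (h a) P (t a)
      returnWalk = let P , w = reachable⇒walk (sc (h a) (t a)) in simplify P w

    closedPath-endingWith : ∃ λ d → ∃ λ ds → IsPath G d ds × t d ≡ h a × lastArc G d ds ≡ a
    closedPath-endingWith with returnWalk
    ... | [] , ha≡ta , _ = a , [] , closedWalk⇒path a [] [-] (sym ha≡ta) refl ([] ∷ []) , sym ha≡ta , refl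
    ... | p ∷ P , w , u =
      let iw , tp , _ = walk⇒isWalk p (P ∷ʳ a) (walk-++ (p ∷ P) w (refl , refl))
      in p , P ∷ʳ a , closedWalk⇒path p (P ∷ʳ a) iw tp (map-++ h (p ∷ P) [ a ]) u , tp , lastArc-∷ʳ p P a

    closedPath-startingWith : ∃ λ ds → IsPath G a ds × h (lastArc G a ds) ≡ t a
    closedPath-startingWith =
      let P , w , u = returnWalk
          V , nodes≡ = walk-nodes P w
          iw , _ , hl = walk⇒isWalk a P (refl , w)
      in P , closedWalk⇒path a P iw refl nodes≡ (unique-rotate V (subst Unique nodes≡ u)) , hl

module _ (G : Graph) where
  open Graph G

  omnitig-forbids : ∀ P {x} M {y R} → IsOmnitig G (P ++ x ∷ M ++ y ∷ R) → ¬ AvoidingPath G (t y) (h x) y x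
  omnitig-forbids P {x} M {y} {R} (_ , _ , forbidden) av
    with i , i≡ , li ← position P (M ++ y ∷ R) refl
    with j , j≡ , lj ← position (P ++ x ∷ M) R (sym (++-assoc P (x ∷ M) (y ∷ R)))
    = forbidden i j i<j (subst₂ (λ a b → AvoidingPath G (t b) (h a) b a) (sym li) (sym lj) av)
    where
    i<j : toℕ i < toℕ j
    i<j = subst₂ _<_ (sym i≡) (sym (trans j≡ (length-++ P))) (ℕₚ.m<m+n (length P) (s≤s z≤n))

  omnitig-first-arc : ∀ P {x} M {y R} → IsOmnitig G (P ++ x ∷ M ++ y ∷ R) →
    ∀ {d ds} → IsPath G d ds → t d ≡ t y → h (lastArc G d ds) ≡ h x → lastArc G d ds ≢ x → d ≡ y
  omnitig-first-arc P M {y} o {d} {ds} p td hl ll with d ≟ y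
  ... | yes d≡y = d≡y
  ... | no d≢y = ⊥-elim (omnitig-forbids P M o (d , ds , p , td , hl , d≢y , ll))

  omnitig-last-arc : ∀ P {x} M {y R} → IsOmnitig G (P ++ x ∷ M ++ y ∷ R) →
    ∀ {d ds} → IsPath G d ds → t d ≡ t y → h (lastArc G d ds) ≡ h x → d ≢ y → lastArc G d ds ≡ x
  omnitig-last-arc P {x} M o {d} {ds} p td hl d≢y with lastArc G d ds ≟ x
  ... | yes ll = ll
  ... | no ll = ⊥-elim (omnitig-forbids P M o (d , ds , p , td , hl , d≢y , ll))

  -- The path is forced onto the next arc of the walk, and it cannot end at a non-join arc c,
  -- since h(c) would then be entered by both c and x.
  omnitig-path-followsʳ : ∀ P {x} N M {y R} → IsOmnitig G (P ++ x ∷ N ++ M ++ y ∷ R) →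
    All (¬_ ∘ JoinArc G) M → ∀ {d ds} → IsPath G d ds →
    t d ≡ h (lastArc G x N) → h (lastArc G d ds) ≡ h x → lastArc G d ds ≢ x →
    ∃ λ ds′ → d ∷ ds ≡ M ++ y ∷ ds′
  omnitig-path-followsʳ P {x} N [] o _ {ds = ds} p td hl ll =
    ds , cong (_∷ ds) (omnitig-first-arc P N o p (trans td (walk-link G x N (linked-++ʳ P (proj₁ o)))) hl ll)
  omnitig-path-followsʳ P {x} N (c ∷ M) {y} {R} o (¬jc ∷ ¬jM) {ds = ds} p td hl ll
    with refl ← omnitig-first-arc P N o p (trans td (walk-link G x N (linked-++ʳ P (proj₁ o)))) hl ll
    = follow ds p hl ll
    where
    follow : ∀ ds → IsPath G c ds → h (lastArc G c ds) ≡ h x → lastArc G c ds ≢ x →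
      ∃ λ ds′ → c ∷ ds ≡ (c ∷ M) ++ y ∷ ds′
    follow [] _ hl ll = ⊥-elim (ll (sym (nonJoin-unique G ¬jc (sym hl))))
    follow (d′ ∷ ds) p@(l ∷ _ , _) hl ll =
      let ds′ , eq = omnitig-path-followsʳ P (N ∷ʳ c) M o′ ¬jM (path-tail G p) td′ hl ll
      in ds′ , cong (c ∷_) eq
      where
      o′ = subst (λ W → IsOmnitig G (P ++ x ∷ W)) (sym (∷ʳ-++ N c (M ++ y ∷ R))) o
      td′ = trans (sym l) (cong h (sym (lastArc-∷ʳ G x N c)))

  omnitig-path-followsˡ : ∀ P {y} M N {x R} → IsOmnitig G (P ++ y ∷ M ++ N ++ x ∷ R) →
    All (¬_ ∘ SplitArc G) M → ∀ {d ds} → IsPath G d ds →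
    t d ≡ t x → d ≢ x → h (lastArc G d ds) ≡ h (lastArc G y M) →
    ∃ λ Q → d ∷ ds ≡ Q ++ y ∷ M
  omnitig-path-followsˡ P {y} M N {x} {R} o ¬s {d} p td d≢x = go (reverseView M) N o ¬s p
    where
    go : ∀ {M} → Reverse M → ∀ N → IsOmnitig G (P ++ y ∷ M ++ N ++ x ∷ R) → All (¬_ ∘ SplitArc G) M →
      ∀ {ds} → IsPath G d ds → h (lastArc G d ds) ≡ h (lastArc G y M) → ∃ λ Q → d ∷ ds ≡ Q ++ y ∷ M
    go [] N o _ {ds} p hl =
      let Q , eq = ∷-lastArc G d ds in Q , trans eq (cong (Q ∷ʳ_) (omnitig-last-arc P N o p td hl d≢x))
    go (M ∶ rs ∶ʳ c) N o ¬sMc {ds} p hl = peel (reverseView ds) p last≡c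
      where
      rest = N ++ x ∷ R
      o₁ : IsOmnitig G ((P ++ y ∷ M) ++ c ∷ rest)
      o₁ = subst (IsOmnitig G)
             (trans (cong (λ W → P ++ y ∷ W) (∷ʳ-++ M c rest)) (sym (++-assoc P (y ∷ M) (c ∷ rest)))) o
      o₂ : IsOmnitig G (P ++ y ∷ M ++ (c ∷ N) ++ x ∷ R)
      o₂ = subst (λ W → IsOmnitig G (P ++ y ∷ W)) (∷ʳ-++ M c rest) o
      ¬sM = proj₁ (∷ʳ⁻ ¬sMc)
      ¬sc = proj₂ (∷ʳ⁻ ¬sMc)
      last≡c : lastArc G d ds ≡ c
      last≡c = omnitig-last-arc (P ++ y ∷ M) N o₁ p td (trans hl (cong h (lastArc-∷ʳ G y M c))) d≢x
      peel : ∀ {ds} → Reverse ds → IsPath G d ds → lastArc G d ds ≡ c →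
        ∃ λ Q → d ∷ ds ≡ Q ++ y ∷ (M ∷ʳ c)
      peel [] _ refl = ⊥-elim (d≢x (sym (nonSplit-unique G ¬sc (sym td))))
      peel (ds ∶ _ ∶ʳ c′) p last≡c =
        let c′≡c = trans (sym (lastArc-∷ʳ G d ds c′)) last≡c
            hl′ = trans (walk-link G d ds (proj₁ p))
                    (trans (cong t c′≡c) (sym (walk-link G y M (linked-++ʳ P (proj₁ o₂)))))
            Q , eq = go rs (c ∷ N) o₂ ¬sM (path-init G ds p) hl′
        in Q , trans (cong₂ _∷ʳ_ eq c′≡c) (++-assoc Q (y ∷ M) [ c ])

  omnitig-++ˡ : ∀ X Y → 1 ≤ length X → IsOmnitig G (X ++ Y) → IsOmnitig G X
  omnitig-++ˡ X Y 1≤X (w , _ , forbidden) = linked-++ˡ X w , 1≤X , λ a j a<j av →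
    let a′ , a≡ , la = lookup-++ˡ X Y a
        j′ , j≡ , lj = lookup-++ˡ X Y j
    in forbidden a′ j′ (subst₂ _<_ (sym a≡) (sym j≡) a<j)
         (subst₂ (λ u v → AvoidingPath G (t u) (h v) u v) (sym lj) (sym la) av)

  omnitig-++ʳ : ∀ X Y → 1 ≤ length Y → IsOmnitig G (X ++ Y) → IsOmnitig G Y
  omnitig-++ʳ X Y 1≤Y (w , _ , forbidden) = linked-++ʳ X w , 1≤Y , λ a j a<j av →
    let a′ , a≡ , la = lookup-++ʳ X Y a
        j′ , j≡ , lj = lookup-++ʳ X Y j
    in forbidden a′ j′ (subst₂ _<_ (sym a≡) (sym j≡) (ℕₚ.+-monoʳ-< (length X) a<j))
         (subst₂ (λ u v → AvoidingPath G (t u) (h v) u v) (sym lj) (sym la) av)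

  noInternalBivalent-++ˡ : ∀ X Y → NoInternalBivalent G (X ++ Y) → NoInternalBivalent G X
  noInternalBivalent-++ˡ X Y nib i 0<i i+1<X =
    let i′ , i≡ , li = lookup-++ˡ X Y i
    in subst (¬_ ∘ BivalentArc G) li
         (nib i′ (subst (0 <_) (sym i≡) 0<i)
           (subst (λ k → suc k < length (X ++ Y)) (sym i≡) (ℕₚ.<-≤-trans i+1<X (length-++-≤ˡ X))))

  noInternalBivalent-++ʳ : ∀ X Y → NoInternalBivalent G (X ++ Y) → NoInternalBivalent G Y
  noInternalBivalent-++ʳ X Y nib i 0<i i+1<Y =
    let i′ , i≡ , li = lookup-++ʳ X Y i
    in subst (¬_ ∘ BivalentArc G) li
         (nib i′ (subst (0 <_) (sym i≡) (ℕₚ.<-≤-trans 0<i (ℕₚ.m≤n+m _ (length X))))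
           (subst (λ k → suc k < length (X ++ Y)) (sym i≡)
             (subst₂ _<_ (ℕₚ.+-suc (length X) (toℕ i)) (sym (length-++ X)) (ℕₚ.+-monoʳ-< (length X) i+1<Y))))

  noInternalBivalent⇒allButLast : ∀ a L → NoInternalBivalent G (a ∷ L) → AllButLast (¬_ ∘ BivalentArc G) L
  noInternalBivalent⇒allButLast a [] _ = tt
  noInternalBivalent⇒allButLast a (x ∷ []) _ = tt
  noInternalBivalent⇒allButLast a (x ∷ y ∷ L) nib =
    nib (Fin.suc Fin.zero) (s≤s z≤n) (s≤s (s≤s (s≤s z≤n))) ,
    noInternalBivalent⇒allButLast x (y ∷ L) (noInternalBivalent-++ʳ [ a ] (x ∷ y ∷ L) nib)

  rightMicro-++ˡ : ∀ {f g} X Y → RightMicro G f g (X ++ Y) → RightMicro G f g X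
  rightMicro-++ˡ {f} {g} X Y (cm , o , nib) =
    cm , omnitig-++ˡ (f ∷ g ∷ X) Y (s≤s z≤n) o , noInternalBivalent-++ˡ (f ∷ g ∷ X) Y nib

  leftMicro-++ʳ : ∀ {f g} X Y → LeftMicro G (X ++ Y) f g → LeftMicro G Y f g
  leftMicro-++ʳ {f} {g} X Y (cm , o , nib) =
    cm , omnitig-++ʳ X (Y ++ f ∷ g ∷ []) (1≤length Y) (subst (IsOmnitig G) assoc o) ,
    noInternalBivalent-++ʳ X (Y ++ f ∷ g ∷ []) (subst (NoInternalBivalent G) assoc nib)
    where
    assoc = ++-assoc X Y (f ∷ g ∷ [])
    1≤length : ∀ Y → 1 ≤ length (Y ++ f ∷ g ∷ [])
    1≤length [] = s≤s z≤n
    1≤length (_ ∷ _) = s≤s z≤n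

  module _ (sc : StronglyConnected G) where

    omnitig-∷ʳ-unique : ∀ L {e e′} → Any (JoinArc G) L →
      IsOmnitig G (L ∷ʳ e) → IsOmnitig G (L ∷ʳ e′) → e ≡ e′
    omnitig-∷ʳ-unique L any-join o o′
      with A , b , C , refl , jb , ¬jC ← split-last (joinArc? G) any-join
      with b′ , b′≢b , hb′ ← join⇒another-arc G jb
      with d , ds , p , td , last≡b′ ← closedPath-endingWith G sc b′
      = ∷-injectiveˡ (++-cancelˡ C _ _ (trans (sym (proj₂ (follows o))) (proj₂ (follows o′))))
      where
      follows : ∀ {e} → IsOmnitig G ((A ++ b ∷ C) ∷ʳ e) → ∃ λ ds′ → d ∷ ds ≡ C ++ e ∷ ds′
      follows {e} o = omnitig-path-followsʳ A [] C (subst (IsOmnitig G) (++-assoc A (b ∷ C) [ e ]) o) ¬jC p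
        (trans td hb′) (trans (cong h last≡b′) hb′) (λ last≡b → b′≢b (trans (sym last≡b′) last≡b))

    omnitig-∷-unique : ∀ L {e e′} → Any (SplitArc G) L →
      IsOmnitig G (e ∷ L) → IsOmnitig G (e′ ∷ L) → e ≡ e′
    omnitig-∷-unique L {e} {e′} any-split o o′
      with C , b , B , refl , ¬sC , sb ← split-first (splitArc? G) any-split
      with b′ , b′≢b , tb′ ← split⇒another-arc G sb
      with ds , p , hl ← closedPath-startingWith G sc b′
      = let Q , eq = follows o ; Q′ , eq′ = follows o′
        in ∷ʳ-injectiveʳ Q Q′ (++-cancelʳ C (Q ∷ʳ e) (Q′ ∷ʳ e′) (begin
             Q ∷ʳ e ++ C    ≡⟨ ∷ʳ-++ Q e C ⟩
             Q ++ e ∷ C     ≡⟨ sym eq ⟩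
             b′ ∷ ds        ≡⟨ eq′ ⟩
             Q′ ++ e′ ∷ C   ≡⟨ sym (∷ʳ-++ Q′ e′ C) ⟩
             Q′ ∷ʳ e′ ++ C  ∎))
      where
      open ≡-Reasoning
      follows : ∀ {e} → IsOmnitig G (e ∷ C ++ b ∷ B) → ∃ λ Q → b′ ∷ ds ≡ Q ++ e ∷ C
      follows {e} o = omnitig-path-followsˡ [] C [] o ¬sC p tb′ b′≢b
        (trans hl (trans tb′ (sym (walk-link G e C (proj₁ o)))))

module _ (G : Graph) (comp : Compressed G) where
  open Graph G

  private
    link-not-biunivocal : ∀ {x y} → h x ≡ t y → ¬ JoinArc G x → ¬ SplitArc G y → ⊥
    link-not-biunivocal {x} l ¬jx ¬sy = proj₁ comp (h x) (¬jx , λ sx → ¬sy (subst (SplitNode G) l sx))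

  split-after : ∀ {x y} → h x ≡ t y → SplitArc G x → ¬ BivalentArc G x → SplitArc G y
  split-after {y = y} l sx ¬bx with splitArc? G y
  ... | yes sy = sy
  ... | no ¬sy = ⊥-elim (link-not-biunivocal l (λ jx → ¬bx (jx , sx)) ¬sy)

  join-before : ∀ {x y} → h x ≡ t y → JoinArc G y → ¬ BivalentArc G y → JoinArc G x
  join-before {x} l jy ¬by with joinArc? G x
  ... | yes jx = jx
  ... | no ¬jx = ⊥-elim (link-not-biunivocal l ¬jx (λ sy → ¬by (jy , sy)))

  splits-forward : ∀ {x} xs → IsWalk G (x ∷ xs) → SplitArc G x →
    AllButLast (¬_ ∘ BivalentArc G) (x ∷ xs) → AllButLast (¬_ ∘ JoinArc G) (x ∷ xs)
  splits-forward [] _ _ _ = tt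
  splits-forward (y ∷ ys) (l ∷ w) sx (¬bx , ¬bs) =
    (λ jx → ¬bx (jx , sx)) , splits-forward ys w (split-after l sx ¬bx) ¬bs

  joins-backward : ∀ xs {z} → IsWalk G (xs ∷ʳ z) → All (¬_ ∘ BivalentArc G) (xs ∷ʳ z) → JoinArc G z →
    All (JoinArc G) (xs ∷ʳ z)
  joins-backward [] _ _ jz = jz ∷ []
  joins-backward (x ∷ []) (l ∷ _) (_ ∷ ¬bz ∷ []) jz = join-before l jz ¬bz ∷ jz ∷ []
  joins-backward (x ∷ x′ ∷ xs) (l ∷ w) (_ ∷ ¬bs) jz with joins-backward (x′ ∷ xs) w ¬bs jz
  ... | js@(jx′ ∷ _) = join-before l jx′ (All.head ¬bs) ∷ js

  rightMicro-nonJoin : ∀ {f g} W → RightMicro G f g W → AllButLast (¬_ ∘ JoinArc G) (g ∷ W)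
  rightMicro-nonJoin {f} {g} W ((_ , _ , sg) , (w , _) , nib) =
    splits-forward W (Linked.tail w) sg (noInternalBivalent⇒allButLast G f (g ∷ W) nib)

  leftMicro-nonSplit : ∀ W {f g} → LeftMicro G W f g → AllButFirst (¬_ ∘ SplitArc G) (W ∷ʳ f)
  leftMicro-nonSplit [] _ = []
  leftMicro-nonSplit (v ∷ V) {f} {g} ((_ , jf , _) , (w , _) , nib) =
    All.zipWith (λ (jx , ¬bx) sx → ¬bx (jx , sx)) (joins-backward V walk ¬bs jf , ¬bs)
    where
    shape : V ++ f ∷ g ∷ [] ≡ (V ∷ʳ f) ∷ʳ g
    shape = sym (∷ʳ-++ V f [ g ])
    walk : IsWalk G (V ∷ʳ f)
    walk = linked-++ˡ (V ∷ʳ f) (subst (IsWalk G) shape (Linked.tail w))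
    ¬bs : All (¬_ ∘ BivalentArc G) (V ∷ʳ f)
    ¬bs = allButLast-∷ʳ _ (V ∷ʳ f)
            (subst (AllButLast _) shape (noInternalBivalent⇒allButLast G v (V ++ f ∷ g ∷ []) nib))

  leftMicro-length : ∀ W {f g} → LeftMicro G W f g → length W ≤ m
  leftMicro-length [] _ = z≤n
  leftMicro-length (v ∷ V) {f} {g} lm@((_ , _ , sg) , (w , _) , _) =
    ℕₚ.≤-trans (ℕₚ.n≤1+n _) (subst (_≤ m) length-eq (length-unique-≤ chain))
    where
    chain : Unique ((V ∷ʳ f) ∷ʳ g)
    chain = unique-chain {R = λ x y → h x ≡ t y} {Good = ¬_ ∘ SplitArc G}
      (λ ¬sz r r′ → nonSplit-unique G ¬sz (trans (sym r′) r))
      (V ∷ʳ f) (subst (IsWalk G) (sym (∷ʳ-++ V f [ g ])) (Linked.tail w))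
      (leftMicro-nonSplit (v ∷ V) lm) (λ ¬sg → ¬sg sg)
    length-eq : length ((V ∷ʳ f) ∷ʳ g) ≡ suc (suc (length V))
    length-eq = trans (length-∷ʳ (V ∷ʳ f)) (cong suc (length-∷ʳ V))

  -- Without its last arc and read backwards, f g W passes only through non-join arcs until f.
  rightMicro-length : ∀ {f g} W → RightMicro G f g W → length W ≤ m
  rightMicro-length {f} {g} W = bound (reverseView W)
    where
    bound : ∀ {W} → Reverse W → RightMicro G f g W → length W ≤ m
    bound [] _ = z≤n
    bound (W ∶ _ ∶ʳ l) rm@((_ , jf , _) , (w , _) , _) =
      subst (_≤ m) (sym (length-∷ʳ W))
        (ℕₚ.≤-trans (ℕₚ.n≤1+n _) (subst (_≤ m) length-eq (length-unique-≤ chain)))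
      where
      chain : Unique (reverse (g ∷ W) ∷ʳ f)
      chain = unique-chain {R = λ x y → h y ≡ t x} {Good = ¬_ ∘ JoinArc G}
        (λ ¬jz r r′ → nonJoin-unique G ¬jz (trans r′ (sym r)))
        (reverse (g ∷ W))
        (subst (Linked _) (unfold-reverse f (g ∷ W)) (linked-reverse (linked-++ˡ (f ∷ g ∷ W) w)))
        (all-reverse (allButLast-∷ʳ _ (g ∷ W) (rightMicro-nonJoin (W ∷ʳ l) rm))) (λ ¬jf → ¬jf jf)
      length-eq : length (reverse (g ∷ W) ∷ʳ f) ≡ suc (suc (length W))
      length-eq = trans (length-∷ʳ (reverse (g ∷ W))) (cong suc (length-reverse (g ∷ W)))

module _ (G : Graph) where
  open Graph G

  isWalk? : ∀ W → Dec (IsWalk G W)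
  isWalk? = Linked.linked? (λ x y → h x ≟ t y)

  isPath? : ∀ e es → Dec (IsPath G e es)
  isPath? e es = isWalk? (e ∷ es) ×-dec distinctExcept? _≟_ (length (e ∷ es)) (nodes G e es)

  avoidingPath? : ∀ u v a b → Dec (AvoidingPath G u v a b)
  avoidingPath? u v a b =
    Dec.map′ (λ (e , es , _ , p) → e , es , p) (λ (e , es , p) → e , es , path-length G (proj₁ p) , p)
      (Finₚ.any? λ e → any-list≤? (λ es → isPath? e es ×-dec t e ≟ u ×-dec h (lastArc G e es) ≟ v ×-dec
                                           ¬? (e ≟ a) ×-dec ¬? (lastArc G e es ≟ b)) n)

  isOmnitig? : ∀ W → Dec (IsOmnitig G W)
  isOmnitig? W = isWalk? W ×-dec 1 ℕₚ.≤? length W ×-dec Finₚ.all? λ a → Finₚ.all? λ j →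
    (toℕ a ℕₚ.<? toℕ j) →-dec ¬? (avoidingPath? (t (lookup W j)) (h (lookup W a)) (lookup W j) (lookup W a))

  noInternalBivalent? : ∀ W → Dec (NoInternalBivalent G W)
  noInternalBivalent? W = Finₚ.all? λ i → (0 ℕₚ.<? toℕ i) →-dec (suc (toℕ i) ℕₚ.<? length W) →-dec
    ¬? (joinArc? G (lookup W i) ×-dec splitArc? G (lookup W i))

  centralMicro? : ∀ f g → Dec (CentralMicro G f g)
  centralMicro? f g = isOmnitig? (f ∷ g ∷ []) ×-dec joinArc? G f ×-dec splitArc? G g

  rightMicro? : ∀ f g W → Dec (RightMicro G f g W)
  rightMicro? f g W = centralMicro? f g ×-dec isOmnitig? (f ∷ g ∷ W) ×-dec noInternalBivalent? (f ∷ g ∷ W)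

  leftMicro? : ∀ W f g → Dec (LeftMicro G W f g)
  leftMicro? W f g =
    centralMicro? f g ×-dec isOmnitig? (W ++ f ∷ g ∷ []) ×-dec noInternalBivalent? (W ++ f ∷ g ∷ [])

module _ (G : Graph) {f g : Arc G} (cm : CentralMicro G f g) where
  open Graph G

  private
    noInternalBivalent-pair : NoInternalBivalent G (f ∷ g ∷ [])
    noInternalBivalent-pair Fin.zero () _
    noInternalBivalent-pair (Fin.suc Fin.zero) _ (s≤s (s≤s ()))

  module _ (comp : Compressed G) where

    maximalRightMicro-exists : ∃ (MaximalRightMicro G f g)
    maximalRightMicro-exists = Maximality.maximal-exists (RightMicro G f g)
      (λ X → Finₚ.any? λ e → rightMicro? G f g (X ∷ʳ e)) m (rightMicro-length G comp)
      (cm , proj₁ cm , noInternalBivalent-pair)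

    maximalLeftMicro-exists : ∃ λ W → MaximalLeftMicro G W f g
    maximalLeftMicro-exists = ConsMaximality.consMaximal-exists (λ W → LeftMicro G W f g)
      (λ W → Finₚ.any? λ e → leftMicro? G (e ∷ W) f g) m (λ W → leftMicro-length G comp W)
      (cm , proj₁ cm , noInternalBivalent-pair)

    microtig-center-unique : ∀ {V₁ f′ g′ V₂ As B} → V₁ ++ f′ ∷ g′ ∷ V₂ ≡ As ++ f ∷ g ∷ B →
      LeftMicro G V₁ f′ g′ → RightMicro G f′ g′ V₂ → V₁ ≡ As × f′ ≡ f × g′ ≡ g × V₂ ≡ B
    microtig-center-unique {V₁} {As = As} eq lm rm
      with refl ← center-unique V₁ As eq (leftMicro-nonSplit G comp V₁ lm) (rightMicro-nonJoin G comp _ rm)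
                    (proj₁ (proj₂ cm)) (proj₂ (proj₂ cm))
      with refl ← ++-cancelˡ V₁ _ _ eq
      = refl , refl , refl , refl

  module _ (sc : StronglyConnected G) where

    maximalRightMicro-unique : ∀ {W W′} → MaximalRightMicro G f g W → MaximalRightMicro G f g W′ → W ≡ W′
    maximalRightMicro-unique = Maximality.maximal-unique (RightMicro G f g) (rightMicro-++ˡ G)
      (λ X rm rm′ → omnitig-∷ʳ-unique G sc (f ∷ g ∷ X) (here (proj₁ (proj₂ cm)))
                      (proj₁ (proj₂ rm)) (proj₁ (proj₂ rm′)))

    maximalLeftMicro-unique : ∀ {W W′} → MaximalLeftMicro G W f g → MaximalLeftMicro G W′ f g → W ≡ W′
    maximalLeftMicro-unique = ConsMaximality.consMaximal-unique (λ W → LeftMicro G W f g) (leftMicro-++ʳ G)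
      (λ X lm lm′ → omnitig-∷-unique G sc (X ++ f ∷ g ∷ []) (Anyₚ.++⁺ʳ X (there (here (proj₂ (proj₂ cm)))))
                      (proj₁ (proj₂ lm)) (proj₁ (proj₂ lm′)))

    module _ (comp : Compressed G) {Lm Rm} (mL : MaximalLeftMicro G Lm f g) (mR : MaximalRightMicro G f g Rm) where

      microtigAt : MicrotigAt G f g (Lm ++ f ∷ g ∷ Rm)
      microtigAt = Lm , Rm , refl , proj₁ mL , proj₁ mR

      maximalMicrotig : MaximalMicrotig G (Lm ++ f ∷ g ∷ Rm)
      maximalMicrotig = (f , g , microtigAt) , no-∷ , no-∷ʳ
        where
        no-∷ : ∀ e → ¬ Microtig G (e ∷ Lm ++ f ∷ g ∷ Rm)
        no-∷ e (_ , _ , _ , _ , eq , lm , rm)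
          with refl , refl , refl , refl ← microtig-center-unique comp {As = e ∷ Lm} (sym eq) lm rm
          = proj₂ mL e lm
        no-∷ʳ : ∀ e → ¬ Microtig G ((Lm ++ f ∷ g ∷ Rm) ∷ʳ e)
        no-∷ʳ e (_ , _ , _ , _ , eq , lm , rm)
          with refl , refl , refl , refl ←
                 microtig-center-unique comp (trans (sym eq) (++-assoc Lm (f ∷ g ∷ Rm) [ e ])) lm rm
          = proj₂ mR e rm

      maximalMicrotig-unique : ∀ W′ → MaximalMicrotig G W′ → MicrotigAt G f g W′ → W′ ≡ Lm ++ f ∷ g ∷ Rm
      maximalMicrotig-unique _ (_ , no-∷ , no-∷ʳ) (W₁ , W₂ , refl , lm , rm) =
        cong₂ (λ L R → L ++ f ∷ g ∷ R)
          (maximalLeftMicro-unique (lm , λ e lm′ → no-∷ e (f , g , e ∷ W₁ , W₂ , refl , lm′ , rm)) mL)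
          (maximalRightMicro-unique
             (rm , λ e rm′ → no-∷ʳ e (f , g , W₁ , W₂ ∷ʳ e , ++-assoc W₁ (f ∷ g ∷ W₂) [ e ] , lm , rm′)) mR)

      maximalMicrotig-exists-unique : Σ (List (Arc G)) λ W → (MaximalMicrotig G W × MicrotigAt G f g W) ×
        ((W′ : List (Arc G)) → MaximalMicrotig G W′ → MicrotigAt G f g W′ → W′ ≡ W)
      maximalMicrotig-exists-unique = Lm ++ f ∷ g ∷ Rm , (maximalMicrotig , microtigAt) , maximalMicrotig-unique

lemma19 : (G : Graph) → StronglyConnected G → Compressed G → ¬ IsClosedPath G →
    (f g : Arc G) → CentralMicro G f g →
    (((W W′ : List (Arc G)) → MaximalRightMicro G f g W → MaximalRightMicro G f g W′ → W ≡ W′)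
      × ((W W′ : List (Arc G)) → MaximalLeftMicro G W f g → MaximalLeftMicro G W′ f g → W ≡ W′))
    × Σ (List (Arc G)) (λ W → (MaximalMicrotig G W × MicrotigAt G f g W)
        × ((W′ : List (Arc G)) → MaximalMicrotig G W′ → MicrotigAt G f g W′ → W′ ≡ W))
-- A closed path has no join arc, so the existence of f makes the hypothesis ¬ IsClosedPath G redundant.
lemma19 G sc comp _ f g cm =
  ((λ _ _ → maximalRightMicro-unique G cm sc) , (λ _ _ → maximalLeftMicro-unique G cm sc)) ,
  maximalMicrotig-exists-unique G cm sc comp
    (proj₂ (maximalLeftMicro-exists G cm comp)) (proj₂ (maximalRightMicro-exists G cm comp))
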